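{- Let $F(x)\in\mathbb{Z}[x]$ have positive leading coefficient, and let $n_F$ be a fixed positive integer such that whenever $a>n_F$ and $1\le b<a$ we have $F(b)<F(a)$ and $F(a)>0$. For $N\ge1$ let $E_F(N)$ be the set of lattice points $(a,h)\in\{1,\dots,N\}^2$ that are invisible along $F$ and such that whenever some point $(b,k)$ with $k\in\mathbb{Z}$ blocks $(a,h)$ from being visible along $F$, we have $b\le n_F$. Then $\#E_F(N)\ll_F N$.
   Context: A lattice point $(a,h)\in\mathbb{Z}_{>0}\times\mathbb{Z}_{>0}$ is visible along $F(x)$ if there exists $t\in\mathbb{Q}$ such that $h=t\,F(a)$ and $a$ is the smallest positive integer $u$ such that $t\,F(u)$ is a positive integer; otherwise it is invisible along $F(x)$. A point $(b,k)$ blocks $(a,h)$ from being visible along $F(x)$ if $b<a$ and there exists $t\in\mathbb{Q}$ with $h=t\,F(a)$ and $k=t\,F(b)$. -}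

module Defs where

open import Data.Nat as ℕ using (ℕ; zero; suc)
open import Data.Integer as ℤ using (ℤ; +_)
open import Data.Rational as ℚ using (ℚ)
open import Data.List using (List; []; _∷_)
open import Data.Product using (Σ; ∃; _×_; _,_)
open import Relation.Binary.PropositionalEquality using (_≡_)
open import Relation.Nullary using (¬_)

-- A polynomial in ℤ[x] is its list of coefficients, lowest degree first:
-- c₀ ∷ c₁ ∷ … ∷ c_d  represents  c₀ + c₁ x + … + c_d x^d.
Poly : Set
Poly = List ℤ

eval : Poly → ℤ → ℤ
eval []       x = + 0
eval (c ∷ cs) x = c ℤ.+ x ℤ.* eval cs x

-- Last coefficient of the list (0 for the empty list). If it is positive,
-- it is the leading coefficient.
lastCoeff : Poly → ℤ
lastCoeff []           = + 0
lastCoeff (c ∷ [])     = c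
lastCoeff (c ∷ d ∷ cs) = lastCoeff (d ∷ cs)

PosLead : Poly → Set
PosLead F = + 0 ℤ.< lastCoeff F

ι : ℤ → ℚ
ι z = z ℚ./ 1

Fq : Poly → ℕ → ℚ
Fq F u = ι (eval F (+ u))

IsPosInt : ℚ → Set
IsPosInt q = Σ ℕ λ m → (0 ℕ.< m) × (q ≡ ι (+ m))

Visible : Poly → ℕ → ℕ → Set
Visible F a h =
  Σ ℚ λ t →
    (ι (+ h) ≡ t ℚ.* Fq F a)
    × IsPosInt (t ℚ.* Fq F a)
    × (∀ u → 0 ℕ.< u → u ℕ.< a → ¬ IsPosInt (t ℚ.* Fq F u))

Invisible : Poly → ℕ → ℕ → Set
Invisible F a h = ¬ Visible F a h

Blocks : Poly → ℕ → ℤ → ℕ → ℕ → Set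
Blocks F b k a h =
  (b ℕ.< a) × (Σ ℚ λ t → (ι (+ h) ≡ t ℚ.* Fq F a) × (ι k ≡ t ℚ.* Fq F b))

InE : Poly → ℕ → ℕ → ℕ × ℕ → Set
InE F nF N (a , h) =
  (1 ℕ.≤ a) × (a ℕ.≤ N) × (1 ℕ.≤ h) × (h ℕ.≤ N)
  × Invisible F a h
  × (∀ (b : ℕ) (k : ℤ) → Blocks F b k a h → b ℕ.≤ nF)

NFHyp : Poly → ℕ → Set
NFHyp F nF = ∀ (a b : ℕ) → nF ℕ.< a → 1 ℕ.≤ b → b ℕ.< a →
  (eval F (+ b) ℤ.< eval F (+ a)) × (+ 0 ℤ.< eval F (+ a))

{-# OPTIONS --safe #-}
-- Let M = max ∣F∣ on [0, n_F] and A = n_F + M n_F. If a > A, put t = h / F(a).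
-- Any u < a with t F(u) a positive integer m makes (u, m) a blocker, so u ≤ n_F.
-- But F(u) ∣ F(b) for b = u + ∣F(u)∣ n_F (polynomials respect congruences), so
-- t F(b) is an integer and (b, t F(b)) is a blocker with n_F < b ≤ A < a: for a
-- point of E_F(N) this is impossible, hence (a, h) would be visible. So every
-- point of E_F(N) lies in [1, A] × [1, N], and #E_F(N) ≤ A N.
module Submission where

open import Defs
open import Data.Nat as ℕ using (ℕ; suc; _≤_; _<_; _*_; _+_; z≤n; s≤s)
import Data.Nat.Properties as ℕP
open import Data.Integer as ℤ using (ℤ; +_; ∣_∣; 0ℤ)
import Data.Integer.Properties as ℤP
open import Data.Integer.Divisibility.Signed
  using (_∣_; divides; ∣-refl; m∣∣m∣; ∣m⇒∣m*n; ∣n⇒∣m*n; ∣m∣n⇒∣m+n; ∣m+n∣n⇒∣m; ∣m⇒∣-m)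
open import Data.Integer.Tactic.RingSolver using (solve-∀)
import Data.Rational as ℚ
import Data.Rational.Properties as ℚP
import Data.Rational.Unnormalised as ℚᵘ
import Data.Rational.Unnormalised.Properties as ℚᵘP
open import Data.List using (List; []; _∷_; length; map; upTo; applyUpTo; cartesianProduct)
open import Data.List.Properties using (length-++; length-map; length-applyUpTo; length-removeAt′)
open import Data.List.Extrema.Nat using (max; xs≤max)
open import Data.List.Membership.Propositional using (_∈_)
open import Data.List.Membership.Propositional.Properties
  using (∈-map⁺; ∈-upTo⁺; ∈-applyUpTo⁺; ∈-cartesianProduct⁺)
open import Data.List.Relation.Binary.Subset.Propositional using (_⊆_)
open import Data.List.Relation.Unary.Any using (here; there; index; _─_)
open import Data.List.Relation.Unary.All as All using (All)
open import Data.List.Relation.Unary.AllPairs using ([]; _∷_)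
open import Data.List.Relation.Unary.Unique.Propositional using (Unique)
open import Data.Product using (Σ; _×_; _,_; proj₂)
open import Data.Empty using (⊥-elim)
open import Function using (_∘_)
open import Relation.Nullary using (¬_)
open import Relation.Binary.PropositionalEquality

ι-injective : ∀ {x y} → ι x ≡ ι y → x ≡ y
ι-injective {x} {y} ιx≡ιy with ℚP.fromℚᵘ-injective {ℚᵘ.mkℚᵘ x 0} {ℚᵘ.mkℚᵘ y 0} ιx≡ιy
... | ℚᵘ.*≡* x*1≡y*1 = trans (sym (ℤP.*-identityʳ x)) (trans x*1≡y*1 (ℤP.*-identityʳ y))

ι-homo-* : ∀ x y → ι (x ℤ.* y) ≡ ι x ℚ.* ι y
ι-homo-* x y = ℚP.toℚᵘ-injective (ℚᵘP.≃-trans (toℚᵘ-ι (x ℤ.* y)) (ℚᵘP.≃-sym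
  (ℚᵘP.≃-trans (ℚP.toℚᵘ-homo-* (ι x) (ι y)) (ℚᵘP.*-cong (toℚᵘ-ι x) (toℚᵘ-ι y)))))
  where
  toℚᵘ-ι : ∀ z → ℚ.toℚᵘ (ι z) ℚᵘ.≃ ℚᵘ.mkℚᵘ z 0
  toℚᵘ-ι z = ℚP.toℚᵘ-fromℚᵘ (ℚᵘ.mkℚᵘ z 0)

∣⇒integral-multiple : ∀ t {x y m} → x ∣ y → ι m ≡ t ℚ.* ι x →
                      Σ ℤ λ k → ι k ≡ t ℚ.* ι y
∣⇒integral-multiple t {x} {y} {m} (divides q y≡q*x) m≡t*x = q ℤ.* m , (begin
  ι (q ℤ.* m)           ≡⟨ ι-homo-* q m ⟩
  ι q ℚ.* ι m           ≡⟨ cong (ι q ℚ.*_) m≡t*x ⟩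
  ι q ℚ.* (t ℚ.* ι x)   ≡⟨ ℚP.*-assoc (ι q) t (ι x) ⟨
  (ι q ℚ.* t) ℚ.* ι x   ≡⟨ cong (ℚ._* ι x) (ℚP.*-comm (ι q) t) ⟩
  (t ℚ.* ι q) ℚ.* ι x   ≡⟨ ℚP.*-assoc t (ι q) (ι x) ⟩
  t ℚ.* (ι q ℚ.* ι x)   ≡⟨ cong (t ℚ.*_) (ι-homo-* q x) ⟨
  t ℚ.* ι (q ℤ.* x)     ≡⟨ cong (λ z → t ℚ.* ι z) y≡q*x ⟨
  t ℚ.* ι y             ∎)
  where open ≡-Reasoning

∣y⇒∣eval[x+y]-eval[x] : ∀ F x {d y} → d ∣ y → d ∣ eval F (x ℤ.+ y) ℤ.- eval F x
∣y⇒∣eval[x+y]-eval[x] []       x d∣y = divides 0ℤ refl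
∣y⇒∣eval[x+y]-eval[x] (c ∷ cs) x {d} {y} d∣y =
  subst (d ∣_) (sym (horner-step c x y (eval cs x) (eval cs (x ℤ.+ y))))
    (∣m∣n⇒∣m+n (∣n⇒∣m*n x (∣y⇒∣eval[x+y]-eval[x] cs x d∣y)) (∣m⇒∣m*n _ d∣y))
  where
  horner-step : ∀ c x y p q →
    (c ℤ.+ (x ℤ.+ y) ℤ.* q) ℤ.- (c ℤ.+ x ℤ.* p) ≡ x ℤ.* (q ℤ.- p) ℤ.+ y ℤ.* q
  horner-step = solve-∀

eval[x]∣eval[x+y] : ∀ F x {y} → eval F x ∣ y → eval F x ∣ eval F (x ℤ.+ y)
eval[x]∣eval[x+y] F x Fx∣y =
  ∣m+n∣n⇒∣m (∣y⇒∣eval[x+y]-eval[x] F x Fx∣y) (∣m⇒∣-m ∣-refl)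

Unique-⊆⇒length-≤ : ∀ {A : Set} {xs ys : List A} → Unique xs → xs ⊆ ys →
                    length xs ≤ length ys
Unique-⊆⇒length-≤ [] _ = z≤n
Unique-⊆⇒length-≤ {xs = x ∷ xs} {ys} (x∉xs ∷ unique) xs⊆ys =
  subst (suc (length xs) ≤_) (sym (length-removeAt′ ys (index x∈ys)))
    (s≤s (Unique-⊆⇒length-≤ unique xs⊆ys─x))
  where
  x∈ys : x ∈ ys
  x∈ys = xs⊆ys (here refl)
  ∈-─⁺ : ∀ {z zs} (p : x ∈ zs) → x ≢ z → z ∈ zs → z ∈ (zs ─ p)
  ∈-─⁺ (here refl) x≢z (here refl) = ⊥-elim (x≢z refl)
  ∈-─⁺ (here _)    _   (there z∈zs) = z∈zs
  ∈-─⁺ (there _)   _   (here z≡y)   = here z≡y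
  ∈-─⁺ (there p)   x≢z (there z∈zs) = there (∈-─⁺ p x≢z z∈zs)
  xs⊆ys─x : xs ⊆ (ys ─ x∈ys)
  xs⊆ys─x z∈xs = ∈-─⁺ x∈ys (All.lookup x∉xs z∈xs) (xs⊆ys (there z∈xs))

length-cartesianProduct : ∀ {A B : Set} (xs : List A) (ys : List B) →
                          length (cartesianProduct xs ys) ≡ length xs * length ys
length-cartesianProduct []       ys = refl
length-cartesianProduct (x ∷ xs) ys = trans (length-++ (map (x ,_) ys))
  (cong₂ _+_ (length-map (x ,_) ys) (length-cartesianProduct xs ys))

grid : ℕ → ℕ → List (ℕ × ℕ)
grid A N = cartesianProduct (applyUpTo suc A) (applyUpTo suc N)

length-grid : ∀ A N → length (grid A N) ≡ A * N
length-grid A N = trans (length-cartesianProduct (applyUpTo suc A) (applyUpTo suc N))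
  (cong₂ _*_ (length-applyUpTo suc A) (length-applyUpTo suc N))

∈-grid : ∀ {A N a h} → 1 ≤ a → a ≤ A → 1 ≤ h → h ≤ N → (a , h) ∈ grid A N
∈-grid {a = suc a} {suc h} _ a<A _ h<N =
  ∈-cartesianProduct⁺ (∈-applyUpTo⁺ suc a<A) (∈-applyUpTo⁺ suc h<N)

module _ (F : Poly) (nF : ℕ) where

  maxAbsEval : ℕ
  maxAbsEval = max 0 (map (λ u → ∣ eval F (+ u) ∣) (upTo (suc nF)))

  ∣eval∣≤maxAbsEval : ∀ {u} → u ≤ nF → ∣ eval F (+ u) ∣ ≤ maxAbsEval
  ∣eval∣≤maxAbsEval u≤nF = All.lookup (xs≤max 0 _)
    (∈-map⁺ (λ u → ∣ eval F (+ u) ∣) (∈-upTo⁺ (s≤s u≤nF)))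

  bound : ℕ
  bound = nF + maxAbsEval * nF

  companion : ℕ → ℕ
  companion u = u + ∣ eval F (+ u) ∣ * nF

  companion≤bound : ∀ {u} → u ≤ nF → companion u ≤ bound
  companion≤bound u≤nF = ℕP.+-mono-≤ u≤nF (ℕP.*-monoˡ-≤ nF (∣eval∣≤maxAbsEval u≤nF))

  nF<companion : ∀ {u} → 0 < u → eval F (+ u) ≢ 0ℤ → nF < companion u
  nF<companion 0<u Fu≢0 = ℕP.+-mono-≤ 0<u (ℕP.m≤n*m nF _ {{ℕ.≢-nonZero (Fu≢0 ∘ ℤP.∣i∣≡0⇒i≡0)}})

  eval∣eval-companion : ∀ u → eval F (+ u) ∣ eval F (+ companion u)
  eval∣eval-companion u = subst (λ x → eval F (+ u) ∣ eval F x) (sym +companion)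
    (eval[x]∣eval[x+y] F (+ u) (∣m⇒∣m*n (+ nF) m∣∣m∣))
    where
    +companion : + companion u ≡ + u ℤ.+ + ∣ eval F (+ u) ∣ ℤ.* + nF
    +companion = trans (ℤP.pos-+ u _) (cong (ℤ._+_ (+ u)) (ℤP.pos-* ∣ eval F (+ u) ∣ nF))

  visible-beyond-bound : ∀ {a h} → bound < a → eval F (+ a) ≢ 0ℤ → 1 ≤ h →
                         (∀ b k → Blocks F b k a h → b ≤ nF) → Visible F a h
  visible-beyond-bound {a} {h} bound<a Fa≢0 1≤h blockers≤nF =
    t , h≡t*Fa , (h , 1≤h , sym h≡t*Fa) , no-earlier
    where
    instance
      Fa-nonZero : ℚ.NonZero (Fq F a)
      Fa-nonZero = ℚ.≢-nonZero (Fa≢0 ∘ ι-injective)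

    t : ℚ.ℚ
    t = ι (+ h) ℚ.÷ Fq F a

    h≡t*Fa : ι (+ h) ≡ t ℚ.* Fq F a
    h≡t*Fa = sym (begin
      (ι (+ h) ℚ.* ℚ.1/ Fq F a) ℚ.* Fq F a ≡⟨ ℚP.*-assoc (ι (+ h)) _ _ ⟩
      ι (+ h) ℚ.* (ℚ.1/ Fq F a ℚ.* Fq F a) ≡⟨ cong (ι (+ h) ℚ.*_) (ℚP.*-inverseˡ (Fq F a)) ⟩
      ι (+ h) ℚ.* ℚ.1ℚ                     ≡⟨ ℚP.*-identityʳ (ι (+ h)) ⟩
      ι (+ h)                              ∎)
      where open ≡-Reasoning

    no-earlier : ∀ u → 0 < u → u < a → ¬ IsPosInt (t ℚ.* Fq F u)
    no-earlier u 0<u u<a (m , 0<m , t*Fu≡m) =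
      ℕP.<⇒≱ (nF<companion 0<u Fu≢0) companion≤nF
      where
      u≤nF : u ≤ nF
      u≤nF = blockers≤nF u (+ m) (u<a , t , h≡t*Fa , sym t*Fu≡m)
      Fu≢0 : eval F (+ u) ≢ 0ℤ
      Fu≢0 Fu≡0 = ℕP.<⇒≢ 0<m (sym (ℤP.+-injective (ι-injective (begin
        ι (+ m)           ≡⟨ t*Fu≡m ⟨
        t ℚ.* Fq F u      ≡⟨ cong (λ x → t ℚ.* ι x) Fu≡0 ⟩
        t ℚ.* ℚ.0ℚ        ≡⟨ ℚP.*-zeroʳ t ⟩
        ι 0ℤ              ∎))))
        where open ≡-Reasoning
      b<a : companion u < a
      b<a = ℕP.≤-<-trans (companion≤bound u≤nF) bound<a
      companion≤nF : companion u ≤ nF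
      companion≤nF =
        let k , k≡t*Fb = ∣⇒integral-multiple t {m = + m} (eval∣eval-companion u) (sym t*Fu≡m)
        in  blockers≤nF (companion u) k (b<a , t , h≡t*Fa , k≡t*Fb)

  InE⇒∈grid : (∀ {a} → nF < a → eval F (+ a) ≢ 0ℤ) →
              ∀ {N p} → InE F nF N p → p ∈ grid bound N
  InE⇒∈grid F≢0 {p = a , _} (1≤a , _ , 1≤h , h≤N , invisible , blockers≤nF) =
    ∈-grid 1≤a (ℕP.≮⇒≥ bound≮a) 1≤h h≤N
    where
    bound≮a : ¬ bound < a
    bound≮a bound<a = invisible (visible-beyond-bound bound<a
      (F≢0 (ℕP.≤-<-trans (ℕP.m≤m+n nF _) bound<a)) 1≤h blockers≤nF)

NFHyp⇒eval≢0 : ∀ {F nF} → 0 < nF → NFHyp F nF → ∀ {a} → nF < a → eval F (+ a) ≢ 0ℤ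
NFHyp⇒eval≢0 0<nF hyp {a} nF<a =
  ≢-sym (ℤP.<⇒≢ (proj₂ (hyp a 1 nF<a ℕP.≤-refl (ℕP.≤-<-trans 0<nF nF<a))))

-- The sign of the leading coefficient plays no role: only F(a) ≠ 0 for a > n_F is used.
lemma2p2 : (F : Poly) → PosLead F → (nF : ℕ) → 0 < nF → NFHyp F nF →
    Σ ℕ λ C → ∀ (N : ℕ) → 1 ≤ N → (L : List (ℕ × ℕ)) → Unique L →
      All (InE F nF N) L → length L ≤ C * N
lemma2p2 F _ nF 0<nF hyp = bound F nF , λ N _ L unique L⊆E →
  subst (length L ≤_) (length-grid (bound F nF) N)
    (Unique-⊆⇒length-≤ unique (InE⇒∈grid F nF (NFHyp⇒eval≢0 {F} 0<nF hyp) ∘ All.lookup L⊆E))
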